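{- Let $\sigma_1<\dots<\sigma_r$ be the samples of a text $T[1..n]$ and let $t_1<t_2<\dots$ be the remaining samples after subsampling with parameter $s$ (as defined in the context). If there is a removed sample $\sigma_j$ and an index $i$ with $t_i<\sigma_j<t_{i+1}$, then $t_{i+1}-t_i\le s$.
   Context: Let $T[1..n]$ be a text, $\mathrm{SA}$ its suffix array and $\mathrm{BWT}$ its Burrows–Wheeler Transform ($\mathrm{BWT}[j]=T[\mathrm{SA}[j]-1]$, or $T[n]$ if $\mathrm{SA}[j]=1$), which has $r$ maximal runs of equal letters. The sample of a run is the text position $\mathrm{SA}[j]-1$ (or $n$ if $\mathrm{SA}[j]=1$) of the last letter $\mathrm{BWT}[j]$ of that run; let $\sigma_1<\dots<\sigma_r$ be the samples sorted. Given an integer $s\ge1$, subsampling processes $i=2,3,\dots,r-1$ in order and removes $\sigma_i$ iff $\sigma_{i+1}-\tau\le s$, where $\tau$ is the largest sample smaller than $\sigma_i$ not removed so far; $\sigma_1,\sigma_r$ are never removed. The non-removed samples, in increasing order, are $t_1<t_2<\cdots$. -}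

module Defs where

open import Data.Nat using (ℕ; zero; suc; _∸_; _≤_; _<_; _≤?_)
open import Data.List using (List; []; _∷_; drop; length)
open import Data.Maybe using (Maybe; nothing; just)
open import Data.Product using (_×_; ∃)
open import Data.Sum using (_⊎_)
open import Relation.Nullary using (yes; no)
open import Relation.Binary.PropositionalEquality using (_≡_; _≢_)

-- Texts are lists of letters over the ordered alphabet ℕ; positions are 1-based.

data _<ˡ_ : List ℕ → List ℕ → Set where
  []<∷  : ∀ {y ys} → [] <ˡ (y ∷ ys)
  here  : ∀ {x y xs ys} → x < y → (x ∷ xs) <ˡ (y ∷ ys)
  there : ∀ {x xs ys} → xs <ˡ ys → (x ∷ xs) <ˡ (x ∷ ys)

suffix : List ℕ → ℕ → List ℕ
suffix T i = drop (i ∸ 1) T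

letter : List ℕ → ℕ → Maybe ℕ
letter T i with drop (i ∸ 1) T
... | []    = nothing
... | x ∷ _ = just x

record IsSuffixArray (T : List ℕ) (SA : ℕ → ℕ) : Set where
  field
    inRange : ∀ j → 1 ≤ j → j ≤ length T → 1 ≤ SA j × SA j ≤ length T
    sorted  : ∀ j k → 1 ≤ j → j < k → k ≤ length T →
              suffix T (SA j) <ˡ suffix T (SA k)

prevPos : ℕ → ℕ → ℕ
prevPos n zero          = n   -- never used (positions are ≥ 1)
prevPos n (suc zero)    = n
prevPos n (suc (suc m)) = suc m

bwtPos : List ℕ → (ℕ → ℕ) → ℕ → ℕ
bwtPos T SA j = prevPos (length T) (SA j)

BWT : List ℕ → (ℕ → ℕ) → ℕ → Maybe ℕ
BWT T SA j = letter T (bwtPos T SA j)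

RunEnd : List ℕ → (ℕ → ℕ) → ℕ → Set
RunEnd T SA j = 1 ≤ j × j ≤ length T ×
                (j ≡ length T ⊎ BWT T SA j ≢ BWT T SA (suc j))

IsSample : List ℕ → (ℕ → ℕ) → ℕ → Set
IsSample T SA p = ∃ λ j → RunEnd T SA j × bwtPos T SA j ≡ p

-- Subsampling of a sorted list of samples σ₁ < … < σ_r with parameter s.
-- go s τ x rest : τ = last kept sample, x = current candidate σ_i,
-- rest = σ_{i+1} … σ_r.
go : ℕ → ℕ → ℕ → List ℕ → List ℕ
go s τ x [] = x ∷ []
go s τ x (y ∷ rest) with y ∸ τ ≤? s
... | yes _ = go s τ y rest
... | no  _ = x ∷ go s x y rest

subsample : ℕ → List ℕ → List ℕ
subsample s []            = []
subsample s (x ∷ [])      = x ∷ []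
subsample s (x ∷ y ∷ rest) = x ∷ go s x y rest

-- While a candidate σ_i is being removed, the last kept sample τ does not change and the
-- next candidate σ_{i+1} is within s of τ. Hence the first sample kept after a removed one
-- is within s of the last sample kept before it, and these two are the consecutive kept
-- samples bracketing the removed one.
module Submission where

open import Defs
open import Data.Nat using (ℕ; _∸_; _≤_; _<_; _≤?_)
open import Data.Nat.Properties using (<-trans; <-asym)
open import Data.List using (List; []; _∷_; _++_)
open import Data.List.Properties using (∷-injective; ∷-injectiveʳ)
open import Data.List.Relation.Unary.All using (lookup)
open import Data.List.Relation.Unary.AllPairs using (AllPairs; _∷_)
open import Data.List.Relation.Unary.Linked using (Linked)
open import Data.List.Relation.Unary.Linked.Properties using (Linked⇒AllPairs)
open import Data.List.Relation.Unary.Any using (here; there)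
open import Data.List.Membership.Propositional using (_∈_; _∉_)
open import Data.List.Membership.Propositional.Properties using (∈-++⁺ʳ)
open import Data.Empty using (⊥-elim)
open import Data.Product using (_,_)
open import Function.Base using (_∘_)
open import Function.Bundles using (_⇔_)
open import Relation.Nullary using (yes; no)
open import Relation.Binary.PropositionalEquality using (_≡_; refl)

go-⊆ : ∀ s τ c rest {z} → z ∈ go s τ c rest → z ∈ c ∷ rest
go-⊆ s τ c [] z∈ = z∈
go-⊆ s τ c (y ∷ rest) z∈ with y ∸ τ ≤? s
... | yes _ = there (go-⊆ s τ y rest z∈)
go-⊆ s τ c (y ∷ rest) (here refl) | no _ = here refl
go-⊆ s τ c (y ∷ rest) (there z∈) | no _ = there (go-⊆ s c y rest z∈)

go-head-near : ∀ s τ c rest {b l} → c ∸ τ ≤ s → go s τ c rest ≡ b ∷ l → b ∸ τ ≤ s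
go-head-near s τ c [] c-near refl = c-near
go-head-near s τ c (y ∷ rest) c-near eq with y ∸ τ ≤? s
... | yes y-near = go-head-near s τ y rest y-near eq
go-head-near s τ c (y ∷ rest) c-near refl | no _ = c-near

∈-≡-++ : ∀ pre {l L : List ℕ} {x : ℕ} → L ≡ pre ++ x ∷ l → x ∈ L
∈-≡-++ pre refl = ∈-++⁺ʳ pre (here refl)

go-removed-gap≤ : ∀ s τ c rest → AllPairs _<_ (c ∷ rest) →
                  ∀ {x} → x ∈ c ∷ rest → x ∉ go s τ c rest →
                  ∀ pre {a b} post → τ ∷ go s τ c rest ≡ pre ++ a ∷ b ∷ post →
                  a < x → x < b → b ∸ a ≤ s
go-removed-gap≤ s τ c [] _ (here refl) x∉ _ _ _ _ _ = ⊥-elim (x∉ (here refl))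
go-removed-gap≤ s τ c (y ∷ rest) sorted x∈ x∉ pre post eq a<x x<b with y ∸ τ ≤? s
go-removed-gap≤ s τ c (y ∷ rest) _ (here refl) _ [] _ eq _ _ | yes y-near
  with refl , go≡ ← ∷-injective eq = go-head-near s τ y rest y-near go≡
go-removed-gap≤ s τ c (y ∷ rest) (c< ∷ _) (here refl) _ (_ ∷ pre) _ eq a<x _ | yes _ =
  ⊥-elim (<-asym a<x (lookup c< (go-⊆ s τ y rest (∈-≡-++ pre (∷-injectiveʳ eq)))))
go-removed-gap≤ s τ c (y ∷ rest) (_ ∷ sorted) (there x∈) x∉ pre post eq a<x x<b | yes _ =
  go-removed-gap≤ s τ y rest sorted x∈ x∉ pre post eq a<x x<b
go-removed-gap≤ s τ c (y ∷ rest) _ (here refl) x∉ _ _ _ _ _ | no _ = ⊥-elim (x∉ (here refl))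
go-removed-gap≤ s τ c (y ∷ rest) (c< ∷ _) (there x∈) _ [] _ refl _ x<c | no _ =
  ⊥-elim (<-asym x<c (lookup c< x∈))
go-removed-gap≤ s τ c (y ∷ rest) (_ ∷ sorted) (there x∈) x∉ (_ ∷ pre) post eq a<x x<b | no _ =
  go-removed-gap≤ s c y rest sorted x∈ (x∉ ∘ there) pre post (∷-injectiveʳ eq) a<x x<b

lemma2 : (s : ℕ) → 1 ≤ s → (T : List ℕ) (SA : ℕ → ℕ) → IsSuffixArray T SA →
         (σ : List ℕ) → Linked _<_ σ → (∀ p → (p ∈ σ) ⇔ IsSample T SA p) →
         (x : ℕ) → x ∈ σ → x ∉ subsample s σ →
         (pre : List ℕ) (a b : ℕ) (post : List ℕ) →
         subsample s σ ≡ pre ++ a ∷ b ∷ post →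
         a < x → x < b → b ∸ a ≤ s
lemma2 s _ T SA _ (σ₁ ∷ []) _ _ x (here refl) x∉ _ _ _ _ _ _ _ = ⊥-elim (x∉ (here refl))
lemma2 s _ T SA _ (σ₁ ∷ σ₂ ∷ σs) _ _ x (here refl) x∉ _ _ _ _ _ _ _ = ⊥-elim (x∉ (here refl))
lemma2 s _ T SA _ (σ₁ ∷ σ₂ ∷ σs) sorted _ x (there x∈) x∉ pre a b post eq a<x x<b
  with _ ∷ sortedTail ← Linked⇒AllPairs <-trans sorted =
  go-removed-gap≤ s σ₁ σ₂ σs sortedTail x∈ (x∉ ∘ there) pre post eq a<x x<b
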